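{- Let $k\geq 1$ and let $a\geq 0$ be an integer with $k$-binomial representation $a=\sum_{i=1}^{k}\binom{a_i}{i}$, $0\le a_1<\cdots<a_k$. If $a_1=0$ ($a$ is $k$-short), then $\partial^{k}(a+1)=\partial^{k}(a)+1$; otherwise (if $a_1\geq 1$, i.e. $a$ is $k$-long) $\partial^{k}(a+1)=\partial^{k}(a)$.
   Context: Binomial coefficients follow the convention $\binom{m}{j}=0$ whenever $m<j$ (including negative $m$), and $\binom{m}{0}=1$ for $m\ge 0$. For integers $k\geq 1$ and $n\geq 0$ there is a unique way to write $n=\binom{n_k}{k}+\cdots+\binom{n_1}{1}$ with $0\leq n_1<n_2<\cdots<n_k$ (the $k$-binomial representation of $n$). The Kruskal–Macaulay function is $\partial^{k}(n)=\binom{n_k-1}{k-1}+\binom{n_{k-1}-1}{k-2}+\cdots+\binom{n_1-1}{0}$, computed from the $k$-binomial representation of $n$. -}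

module Defs where

open import Data.Nat using (ℕ; zero; suc; _+_)
open import Data.Fin using (Fin; toℕ) renaming (_<_ to _<ᶠ_)
open import Data.Vec using (sum; tabulate)
open import Data.Nat using (_<_)
open import Relation.Binary.PropositionalEquality using (_≡_)

binom : ℕ → ℕ → ℕ
binom _       zero    = 1
binom zero    (suc j) = 0
binom (suc m) (suc j) = binom m j + binom m (suc j)

-- binomPred n j = binom(n - 1, j) with the integer convention:
-- binom(-1, j) = 0 (since -1 < j for all j ≥ 0).
binomPred : ℕ → ℕ → ℕ
binomPred zero    j = 0
binomPred (suc n) j = binom n j

-- A k-binomial representation of n:  n = Σ_{i=1}^{k} binom(n_i, i)
-- with 0 ≤ n_1 < n_2 < ... < n_k.  Index (i : Fin k) stands for i+1,
-- so  coeff i = n_{toℕ i + 1}.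
record KRep (k n : ℕ) : Set where
  field
    coeff      : Fin k → ℕ
    increasing : ∀ (i j : Fin k) → i <ᶠ j → coeff i < coeff j
    sums       : n ≡ sum (tabulate (λ i → binom (coeff i) (suc (toℕ i))))

open KRep public

∂ : ∀ {k n} → KRep k n → ℕ
∂ {k} r = sum (tabulate (λ i → binomPred (coeff r i) (toℕ i)))

module Submission where

-- Read a k-binomial representation top-down, as the vector
-- v = (a_k, …, a_1) with a_k > … > a_1; the entry at the head of a vector of
-- length m+1 carries degree m+1.  Such a vector has a weight  Σ C(a_i, i)
-- (the represented number) and a shadow  Σ C(a_i - 1, i - 1)  (the value ∂).
--
--  * Uniqueness: the top term dominates, since a descending vector with head
--    x has weight < C(x+1, m+1); hence descending vectors of equal weight
--    coincide (the k-binomial representation is unique).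
--  * Successor: every descending v has a descending successor u of weight one
--    more, whose shadow exceeds that of v by 1 if the bottom entry a_1 is 0
--    and by 0 otherwise.  It is built by induction on the length: increment
--    the lower part, and when that part turns into the "staircase"
--    (b, m-1, …, 1, 0) with b equal to the next entry, carry into that entry
--    via Pascal's rule C(x+1, m+1) = C(x, m) + C(x, m+1).
--
-- The theorem follows: by uniqueness the given representation of a+1 is the
-- successor of the given representation of a.

open import Defs
open import Data.Nat using (ℕ; zero; suc; _+_; _≤_; _<_; _>_; z≤n; s≤s)
open import Data.Nat.Properties
open import Algebra.Properties.CommutativeSemigroup +-commutativeSemigroup
  using (xy∙z≈xz∙y)
open import Data.Fin as Fin using (Fin; toℕ; fromℕ; fromℕ<; inject₁)
open import Data.Fin.Properties using (toℕ-inject₁; toℕ-fromℕ; ℕ<⇒inject₁<)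
open import Data.Vec using (Vec; []; _∷_; head; sum; tabulate)
open import Data.Vec.Properties using (tabulate-cong)
open import Data.Vec.Relation.Unary.Linked as Linked using (Linked; []; [-]; _∷_)
open import Data.Product using (_×_; _,_)
open import Data.Sum using (_⊎_; inj₁; inj₂)
open import Data.Empty using (⊥-elim)
open import Function using (_∘_)
open import Relation.Binary.Definitions using (tri<; tri≈; tri>)
open import Relation.Binary.PropositionalEquality
  using (_≡_; refl; sym; trans; cong; cong₂; subst₂; module ≡-Reasoning)

-- C(n, j) = 0 below the diagonal; makes the staircase weigh nothing.
binom-vanish : ∀ {n j} → n < j → binom n j ≡ 0
binom-vanish {zero}  {suc j} _         = refl
binom-vanish {suc n} {suc j} (s≤s n<j) =
  cong₂ _+_ (binom-vanish n<j) (binom-vanish (m≤n⇒m≤1+n n<j))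

-- C(x, j) is monotone in x; this is why the top term dominates.
binom-monoˡ : ∀ {x y} j → x ≤ y → binom x j ≤ binom y j
binom-monoˡ {x} {y} j x≤y with m≤n⇒m<n∨m≡n x≤y
... | inj₂ refl = ≤-refl
binom-monoˡ {x} {suc y} zero    x≤y | inj₁ _ = ≤-refl
binom-monoˡ {x} {suc y} (suc j) x≤y | inj₁ (s≤s x≤y′) =
  ≤-trans (binom-monoˡ (suc j) x≤y′) (m≤n+m (binom y (suc j)) (binom y j))

binom-pascal-pred : ∀ x j → binom x (suc j) ≡ binomPred x j + binomPred x (suc j)
binom-pascal-pred zero    j = refl
binom-pascal-pred (suc x) j = refl

-- Σ G(x, i) over the entries, the head of a vector of length m+1 having
-- zero-based degree index m.
termSum : (ℕ → ℕ → ℕ) → ∀ {m} → Vec ℕ m → ℕ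
termSum G []               = 0
termSum G {suc m} (x ∷ xs) = termSum G xs + G x m

weight : ∀ {m} → Vec ℕ m → ℕ
weight = termSum (λ x i → binom x (suc i))

shadow : ∀ {m} → Vec ℕ m → ℕ
shadow = termSum binomPred

Descending : ∀ {m} → Vec ℕ m → Set
Descending = Linked _>_

bottom : ∀ {m} → Vec ℕ (suc m) → ℕ
bottom (x ∷ [])     = x
bottom (x ∷ y ∷ ys) = bottom (y ∷ ys)

zeroIndicator : ℕ → ℕ
zeroIndicator zero    = 1
zeroIndicator (suc _) = 0

zeroIndicator-positive : ∀ {n} → 1 ≤ n → zeroIndicator n ≡ 0
zeroIndicator-positive {suc _} _ = refl

length≤head : ∀ {m x} {xs : Vec ℕ m} → Descending (x ∷ xs) → m ≤ x
length≤head {xs = []}    _          = z≤n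
length≤head {xs = _ ∷ _} (y<x ∷ ds) = ≤-trans (s≤s (length≤head ds)) y<x

staircase : ∀ m → Vec ℕ m
staircase zero    = []
staircase (suc m) = m ∷ staircase m

weight-staircase : ∀ m → weight (staircase m) ≡ 0
weight-staircase zero    = refl
weight-staircase (suc m) = cong₂ _+_ (weight-staircase m) (binom-vanish (n<1+n m))

shadow-staircase : ∀ m → shadow (staircase m) ≡ 0
shadow-staircase zero          = refl
shadow-staircase (suc zero)    = refl
shadow-staircase (suc (suc m)) =
  cong₂ _+_ (shadow-staircase (suc m)) (binom-vanish (n<1+n m))

staircase-descending : ∀ {m x} → m ≤ x → Descending (x ∷ staircase m)
staircase-descending {zero}  _   = [-]
staircase-descending {suc m} m<x = m<x ∷ staircase-descending ≤-refl

weight-bound : ∀ {m x} {xs : Vec ℕ m} → Descending (x ∷ xs) →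
               weight (x ∷ xs) < binom (suc x) (suc m)
weight-bound {xs = []}          _          = n<1+n _
weight-bound {m = suc m} {x} {xs = y ∷ ys} (y<x ∷ ds) =
  +-monoˡ-< (binom x (suc (suc m)))
    (<-≤-trans (weight-bound ds) (binom-monoˡ (suc m) y<x))

weight-<-head : ∀ {m x y} {xs ys : Vec ℕ m} → Descending (x ∷ xs) → x < y →
                weight (x ∷ xs) < weight (y ∷ ys)
weight-<-head {m} {y = y} {ys = ys} dx x<y =
  <-≤-trans (weight-bound dx)
    (≤-trans (binom-monoˡ (suc m) x<y) (m≤n+m (binom y (suc m)) (weight ys)))

descending-unique : ∀ {m} {u v : Vec ℕ m} → Descending u → Descending v →
                    weight u ≡ weight v → u ≡ v
descending-unique {u = []}     {[]}     _  _  _ = refl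
descending-unique {suc m} {x ∷ xs} {y ∷ ys} du dv eq with <-cmp x y
... | tri< x<y _ _ = ⊥-elim (<-irrefl eq (weight-<-head {ys = ys} du x<y))
... | tri> _ _ y<x = ⊥-elim (<-irrefl (sym eq) (weight-<-head {ys = xs} dv y<x))
... | tri≈ _ refl _ = cong (x ∷_)
  (descending-unique (Linked.tail du) (Linked.tail dv)
    (+-cancelʳ-≡ (binom x (suc m)) (weight xs) (weight ys) eq))

record Increment {m} (u v : Vec ℕ m) (e : ℕ) : Set where
  constructor increment
  field
    weight-step : weight u ≡ suc (weight v)
    shadow-step : shadow u ≡ shadow v + e

increment-∷ : ∀ {m x e} {u v : Vec ℕ m} → Increment u v e →
              Increment (x ∷ u) (x ∷ v) e
increment-∷ {m} {x} {e} {v = v} (increment w s) =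
  increment (cong (_+ binom x (suc m)) w)
            (trans (cong (_+ binomPred x m) s) (xy∙z≈xz∙y (shadow v) e (binomPred x m)))

increment-single : ∀ x → Increment (suc x ∷ []) (x ∷ []) (zeroIndicator x)
increment-single zero    = increment refl refl
increment-single (suc x) = increment refl refl

-- Carrying into the entry x: by Pascal's rule the vector (x+1, m, …, 0)
-- has the same weight and shadow as (x, x, m-1, …, 0).
carry : ∀ {m x e} {v : Vec ℕ (suc m)} → Increment (x ∷ staircase m) v e →
        Increment (suc x ∷ staircase (suc m)) (x ∷ v) e
carry {m} {x} inc with increment-∷ {x = x} inc
... | increment w s = increment (trans carry-weight w) (trans carry-shadow s)
  where
  open ≡-Reasoning
  carry-weight : weight (suc x ∷ staircase (suc m)) ≡ weight (x ∷ x ∷ staircase m)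
  carry-weight = begin
    weight (staircase (suc m)) + (binom x (suc m) + binom x (suc (suc m)))
      ≡⟨ cong (_+ (binom x (suc m) + binom x (suc (suc m)))) (weight-staircase (suc m)) ⟩
    binom x (suc m) + binom x (suc (suc m))
      ≡⟨ cong (λ w → w + binom x (suc m) + binom x (suc (suc m))) (sym (weight-staircase m)) ⟩
    weight (staircase m) + binom x (suc m) + binom x (suc (suc m))
      ∎
  carry-shadow : shadow (suc x ∷ staircase (suc m)) ≡ shadow (x ∷ x ∷ staircase m)
  carry-shadow = begin
    shadow (staircase (suc m)) + binom x (suc m)
      ≡⟨ cong (_+ binom x (suc m)) (shadow-staircase (suc m)) ⟩
    binom x (suc m)
      ≡⟨ binom-pascal-pred x m ⟩
    binomPred x m + binomPred x (suc m)
      ≡⟨ cong (λ s → s + binomPred x m + binomPred x (suc m)) (sym (shadow-staircase m)) ⟩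
    shadow (staircase m) + binomPred x m + binomPred x (suc m)
      ∎

-- The successor of v, with the shape invariant driving the induction:
-- either the head is unchanged, or everything below a carried head is the
-- staircase.
record Successor {m} (v : Vec ℕ (suc m)) : Set where
  constructor successor
  field
    next       : Vec ℕ (suc m)
    descending : Descending next
    step       : Increment next v (zeroIndicator (bottom v))
    shape      : head next ≡ head v ⊎ next ≡ suc (head v) ∷ staircase m

successor-exists : ∀ {m} {v : Vec ℕ (suc m)} → Descending v → Successor v
successor-exists {v = x ∷ []} _ =
  successor (suc x ∷ []) [-] (increment-single x) (inj₂ refl)
successor-exists {suc m} {x ∷ y ∷ ys} (y<x ∷ ds) with successor-exists ds
... | successor (_ ∷ t) dt inc (inj₁ refl) =
  successor (x ∷ y ∷ t) (y<x ∷ dt) (increment-∷ inc) (inj₁ refl)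
... | successor _ dt inc (inj₂ refl) with m≤n⇒m<n∨m≡n y<x
...   | inj₁ 1+y<x =
  successor (x ∷ suc y ∷ staircase m) (1+y<x ∷ dt) (increment-∷ inc) (inj₁ refl)
...   | inj₂ refl =
  successor (suc x ∷ staircase (suc m))
            (staircase-descending (s≤s (m≤n⇒m≤1+n (length≤head ds))))
            (carry inc) (inj₂ refl)

topDown : ∀ {k} → (Fin k → ℕ) → Vec ℕ k
topDown {zero}  c = []
topDown {suc k} c = c (fromℕ k) ∷ topDown (c ∘ inject₁)

sum-tabulate-last : ∀ {k} (f : Fin (suc k) → ℕ) →
                    sum (tabulate f) ≡ sum (tabulate (f ∘ inject₁)) + f (fromℕ k)
sum-tabulate-last {zero}  f = +-comm (f Fin.zero) 0
sum-tabulate-last {suc k} f =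
  trans (cong (f Fin.zero +_) (sum-tabulate-last (f ∘ Fin.suc)))
        (sym (+-assoc (f Fin.zero) _ _))

termSum-topDown : ∀ {k} (G : ℕ → ℕ → ℕ) (c : Fin k → ℕ) →
                  sum (tabulate (λ i → G (c i) (toℕ i))) ≡ termSum G (topDown c)
termSum-topDown {zero}  G c = refl
termSum-topDown {suc k} G c =
  trans (sum-tabulate-last (λ i → G (c i) (toℕ i)))
    (cong₂ _+_
      (trans (cong sum (tabulate-cong (λ i → cong (G (c (inject₁ i))) (toℕ-inject₁ i))))
             (termSum-topDown G (c ∘ inject₁)))
      (cong (G (c (fromℕ k))) (toℕ-fromℕ k)))

topDown-descending : ∀ {k} (c : Fin k → ℕ) →
                     (∀ i j → i Fin.< j → c i < c j) → Descending (topDown c)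
topDown-descending {zero}        c inc = []
topDown-descending {suc zero}    c inc = [-]
topDown-descending {suc (suc k)} c inc =
  inc (inject₁ (fromℕ k)) (fromℕ (suc k)) (ℕ<⇒inject₁< (n<1+n _))
  ∷ topDown-descending (c ∘ inject₁)
      (λ i j i<j → inc (inject₁ i) (inject₁ j)
                     (subst₂ _<_ (sym (toℕ-inject₁ i)) (sym (toℕ-inject₁ j)) i<j))

bottom-topDown : ∀ {k} (c : Fin (suc k) → ℕ) → bottom (topDown c) ≡ c Fin.zero
bottom-topDown {zero}  c = refl
bottom-topDown {suc k} c = bottom-topDown (c ∘ inject₁)

weight-KRep : ∀ {k n} (r : KRep k n) → weight (topDown (coeff r)) ≡ n
weight-KRep r = sym (trans (sums r) (termSum-topDown _ (coeff r)))

shadow-KRep : ∀ {k n} (r : KRep k n) → ∂ r ≡ shadow (topDown (coeff r))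
shadow-KRep r = termSum-topDown binomPred (coeff r)

∂-successor : ∀ {k a} (r : KRep (suc k) a) (s : KRep (suc k) (a + 1)) →
              ∂ s ≡ ∂ r + zeroIndicator (coeff r Fin.zero)
∂-successor {a = a} r s
  with successor-exists (topDown-descending (coeff r) (increasing r))
... | successor u du (increment w sh) _ = begin
  ∂ s                                                  ≡⟨ shadow-KRep s ⟩
  shadow (topDown (coeff s))                           ≡⟨ cong shadow (sym u≡s) ⟩
  shadow u                                             ≡⟨ sh ⟩
  shadow (topDown (coeff r)) + zeroIndicator (bottom (topDown (coeff r)))
    ≡⟨ cong₂ _+_ (sym (shadow-KRep r)) (cong zeroIndicator (bottom-topDown (coeff r))) ⟩
  ∂ r + zeroIndicator (coeff r Fin.zero)               ∎
  where
  open ≡-Reasoning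
  u≡s : u ≡ topDown (coeff s)
  u≡s = descending-unique du (topDown-descending (coeff s) (increasing s))
    (trans w (trans (cong suc (weight-KRep r))
                    (trans (+-comm 1 a) (sym (weight-KRep s)))))

lemma4 : (k : ℕ) (k≥1 : 1 ≤ k) (a : ℕ)
         (r : KRep k a) (s : KRep k (a + 1)) →
         (coeff r (fromℕ< k≥1) ≡ 0 → ∂ s ≡ ∂ r + 1) ×
         (1 ≤ coeff r (fromℕ< k≥1) → ∂ s ≡ ∂ r)
lemma4 (suc k) (s≤s z≤n) a r s = short , long
  where
  short : coeff r Fin.zero ≡ 0 → ∂ s ≡ ∂ r + 1
  short a₁≡0 = trans (∂-successor r s) (cong (λ n → ∂ r + zeroIndicator n) a₁≡0)
  long : 1 ≤ coeff r Fin.zero → ∂ s ≡ ∂ r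
  long 1≤a₁ = begin
    ∂ s                                    ≡⟨ ∂-successor r s ⟩
    ∂ r + zeroIndicator (coeff r Fin.zero) ≡⟨ cong (∂ r +_) (zeroIndicator-positive 1≤a₁) ⟩
    ∂ r + 0                                ≡⟨ +-identityʳ (∂ r) ⟩
    ∂ r                                    ∎
    where open ≡-Reasoning
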